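{- For every positive integer $n$, there exists an edge-coloring $c$ of $K_{3n}$ that is locally $3$-bounded and globally $9$-bounded and that contains no properly edge-colored spanning tree of radius two.
   Context: An edge-coloring $c$ of $E(K_N)$ is locally $k$-bounded if for every vertex $v$, no color appears on more than $k$ of the edges incident to $v$; it is globally $k$-bounded if no color appears on more than $k$ edges of $K_N$. A subgraph is properly edge-colored if no two of its edges sharing a vertex have the same color. A tree has radius two if it has a vertex at distance at most $2$ from every vertex, and no vertex at distance at most $1$ from every vertex. -}

module Defs where

open import Data.Nat using (ℕ; zero; suc; _≤_)
open import Data.Nat.Properties using () renaming (_≟_ to _≟ℕ_)
open import Data.Fin using (Fin; _<_; _<?_) renaming (_≟_ to _≟F_)
open import Data.List using (List; []; _∷_; length; filter; allFin; cartesianProduct; _∷ʳ_)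
open import Data.List.Relation.Unary.Linked using (Linked)
open import Data.List.Relation.Unary.Unique.Propositional using (Unique)
open import Data.Product using (Σ; ∃; ∃-syntax; _×_; _,_; proj₁; proj₂)
open import Data.Sum using (_⊎_)
open import Relation.Binary.PropositionalEquality using (_≡_; _≢_)
open import Relation.Nullary using (¬_)
open import Relation.Nullary.Decidable using (_×-dec_; ¬?)

-- An edge-coloring of K_N with colours in ℕ is a symmetric function
-- c : Fin N → Fin N → ℕ (the value c u u is irrelevant).
record EdgeColoring (N : ℕ) : Set where
  field
    col : Fin N → Fin N → ℕ
    sym : ∀ u v → col u v ≡ col v u
open EdgeColoring public

localCount : ∀ {N} → EdgeColoring N → Fin N → ℕ → ℕ
localCount {N} c v a =
  length (filter (λ u → (col c v u ≟ℕ a) ×-dec ¬? (u ≟F v)) (allFin N))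

-- number of edges of K_N having colour a (each edge {u,v} counted once, as u < v)
globalCount : ∀ {N} → EdgeColoring N → ℕ → ℕ
globalCount {N} c a =
  length (filter (λ p → (proj₁ p <? proj₂ p) ×-dec (col c (proj₁ p) (proj₂ p) ≟ℕ a))
                 (cartesianProduct (allFin N) (allFin N)))

LocallyBounded : ∀ {N} → ℕ → EdgeColoring N → Set
LocallyBounded k c = ∀ v a → localCount c v a ≤ k

GloballyBounded : ∀ {N} → ℕ → EdgeColoring N → Set
GloballyBounded k c = ∀ a → globalCount c a ≤ k

record SpanningSubgraph (N : ℕ) : Set₁ where
  field
    Adj     : Fin N → Fin N → Set
    adjSym  : ∀ {u v} → Adj u v → Adj v u
    adjIrr  : ∀ {u v} → Adj u v → u ≢ v
open SpanningSubgraph public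

WithinDist : ∀ {N} → SpanningSubgraph N → ℕ → Fin N → Fin N → Set
WithinDist H zero    u v = u ≡ v
WithinDist H (suc k) u v = WithinDist H k u v ⊎ (∃[ w ] (Adj H u w × WithinDist H k w v))

Connected : ∀ {N} → SpanningSubgraph N → Set
Connected H = ∀ u v → ∃[ k ] WithinDist H k u v

-- no cycle x, y₁, …, yₘ, y (m ≥ 1, all distinct, consecutive adjacent, y adjacent to x)
Acyclic : ∀ {N} → SpanningSubgraph N → Set
Acyclic H = ∀ x y ys → 1 ≤ length ys → Unique ((x ∷ ys) ∷ʳ y) →
            Linked (Adj H) ((x ∷ ys) ∷ʳ y) → ¬ Adj H y x

IsTree : ∀ {N} → SpanningSubgraph N → Set
IsTree H = Connected H × Acyclic H

RadiusTwo : ∀ {N} → SpanningSubgraph N → Set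
RadiusTwo {N} H = (∃[ r ] (∀ v → WithinDist H 2 r v)) × ¬ (∃[ r ] (∀ v → WithinDist H 1 r v))

ProperlyColored : ∀ {N} → EdgeColoring N → SpanningSubgraph N → Set
ProperlyColored c H = ∀ u v w → v ≢ w → Adj H u v → Adj H u w → col c u v ≢ col c u w

HasProperSpanningTreeRadiusTwo : ∀ {N} → EdgeColoring N → Set₁
HasProperSpanningTreeRadiusTwo {N} c =
  ∃[ H ] (IsTree {N} H × RadiusTwo H × ProperlyColored c H)

module Submission where

-- Split the vertices 0, …, 3n−1 of K_{3n} into the n classes
-- {3q, 3q+1, 3q+2} and give an edge uv the colour encoding the unordered pair
-- {class u, class v} (a class-internal edge gets the colour of {q, q}).
--
-- Edges of one colour at a vertex v all go to one class (at most 3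
-- vertices); edges of one colour overall join two fixed classes (at most 3 · 3
-- ordered endpoint choices).
--
-- Two vertices of the same class are colour twins: every vertex sees
-- them in the same colour.  In a properly coloured subgraph whose vertex r is
-- within distance 2 of everything, each twin x of r must be a neighbour of r
-- (a path r – w – x would give w two edges of one colour).  As r has two
-- distinct twins, r would then carry two edges of one colour.

open import Defs
open import Data.Nat using (ℕ; suc; _+_; _*_; _≤_; _<_; _⊓_; _⊔_; _/_; _%_; z≤n; s≤s; NonZero)
open import Data.Nat.Properties
open import Data.Nat.DivMod
open import Data.Nat.Divisibility using (divides-refl)
open import Data.Fin as Fin using (Fin; toℕ; fromℕ<)
import Data.Fin.Properties as Fin
open import Data.List using (List; []; _∷_; length; filter; allFin; cartesianProduct)
open import Data.List.Properties using (length-removeAt′)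
open import Data.List.Membership.Propositional using (_∈_)
open import Data.List.Membership.Propositional.Properties using (∈-cartesianProduct⁺)
open import Data.List.Relation.Unary.Any using (here; there; index; _─_)
open import Data.List.Relation.Unary.All as All using (All; []; _∷_)
open import Data.List.Relation.Unary.All.Properties using (all-filter)
open import Data.List.Relation.Unary.AllPairs using (_∷_)
open import Data.List.Relation.Unary.Unique.Propositional using (Unique)
import Data.List.Relation.Unary.Unique.Propositional.Properties as Unique
open import Data.Product using (Σ; _×_; _,_; proj₁; proj₂; ∃-syntax)
open import Data.Sum using (inj₁; inj₂)
open import Data.Empty using (⊥-elim)
open import Function.Base using (_∘_)
open import Function.Definitions using (Injective)
open import Relation.Binary.Definitions using (DecidableEquality)
open import Relation.Binary.PropositionalEquality
  using (_≡_; _≢_; refl; trans; cong; cong₂; subst; module ≡-Reasoning)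
  renaming (sym to ≡-sym)
open import Relation.Nullary using (¬_; Dec; yes; no)
open import Relation.Nullary.Decidable using (_×-dec_; ¬?)

∈-─ : {A : Set} {x y : A} {S : List A} (p : x ∈ S) → y ∈ S → y ≢ x → y ∈ (S ─ p)
∈-─ (here refl) (here refl) y≢x = ⊥-elim (y≢x refl)
∈-─ (here refl) (there q)   _   = q
∈-─ (there p)   (here eq)   _   = here eq
∈-─ (there p)   (there q)   y≢x = there (∈-─ p q y≢x)

unique-length-≤ : {A B : Set} (g : A → B) → Injective _≡_ _≡_ g →
                  (S : List B) (xs : List A) → Unique xs → All (λ x → g x ∈ S) xs →
                  length xs ≤ length S
unique-length-≤ g g-inj S []       _             _        = z≤n
unique-length-≤ g g-inj S (x ∷ xs) (x∉xs ∷ uniq) (p ∷ ps) rewrite length-removeAt′ S (index p) =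
  s≤s (unique-length-≤ g g-inj (S ─ p) xs uniq (restrict x∉xs ps))
  where
  restrict : ∀ {ys} → All (x ≢_) ys → All (λ y → g y ∈ S) ys → All (λ y → g y ∈ (S ─ p)) ys
  restrict []            []       = []
  restrict (x≢y ∷ x≢ys) (q ∷ qs) = ∈-─ p q (λ gy≡gx → x≢y (≡-sym (g-inj gy≡gx))) ∷ restrict x≢ys qs

filter-cluster-≤ : {A B : Set} {P : A → Set} (P? : ∀ x → Dec (P x))
                   (g : A → B) → Injective _≡_ _≡_ g →
                   (S : A → List B) (b : ℕ) → (∀ x → length (S x) ≤ b) →
                   (∀ x y → P x → P y → g y ∈ S x) →
                   (xs : List A) → Unique xs → length (filter P? xs) ≤ b
filter-cluster-≤ {A} {P = P} P? g g-inj S b S≤b confine xs uniq =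
  bound (filter P? xs) (Unique.filter⁺ P? uniq) (all-filter P? xs)
  where
  bound : (ys : List A) → Unique ys → All P ys → length ys ≤ b
  bound []       _       _          = z≤n
  bound (y ∷ ys) uniq-ys ps@(py ∷ _) = ≤-trans
    (unique-length-≤ g g-inj (S y) (y ∷ ys) uniq-ys (All.map (confine y _ py) ps))
    (S≤b y)

-- Reading a + b·d in base d: the pair (a, b) with a < d is recovered.
pair-injective : ∀ {d} .⦃ _ : NonZero d ⦄ {a b a′ b′} → a < d → a′ < d →
                 a + b * d ≡ a′ + b′ * d → a ≡ a′ × b ≡ b′
pair-injective {d} {a} {b} {a′} {b′} a<d a′<d eq = a≡a′ , b≡b′
  where
  open ≡-Reasoning
  a≡a′ : a ≡ a′
  a≡a′ = begin
    a                    ≡⟨ ≡-sym (m<n⇒m%n≡m a<d) ⟩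
    a % d                ≡⟨ ≡-sym ([m+kn]%n≡m%n a b d) ⟩
    (a + b * d) % d      ≡⟨ cong (_% d) eq ⟩
    (a′ + b′ * d) % d    ≡⟨ [m+kn]%n≡m%n a′ b′ d ⟩
    a′ % d               ≡⟨ m<n⇒m%n≡m a′<d ⟩
    a′                   ∎
  b≡b′ : b ≡ b′
  b≡b′ = *-cancelʳ-≡ b b′ d (+-cancelˡ-≡ a _ _ (trans eq (cong (_+ b′ * d) (≡-sym a≡a′))))

-- The code of the unordered pair {i, j}: its minimum and maximum in base d.
unorderedCode : ℕ → ℕ → ℕ → ℕ
unorderedCode d i j = i ⊓ j + (i ⊔ j) * d

unorderedCode-comm : ∀ d i j → unorderedCode d i j ≡ unorderedCode d j i
unorderedCode-comm d i j = cong₂ (λ m M → m + M * d) (⊓-comm i j) (⊔-comm i j)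

-- Equal codes mean equal minima and maxima (the minimum is below d as soon as
-- one entry is).
unorderedCode-injective : ∀ {d} .⦃ _ : NonZero d ⦄ {i j i′ j′} → i < d → i′ < d →
                          unorderedCode d i j ≡ unorderedCode d i′ j′ →
                          i ⊓ j ≡ i′ ⊓ j′ × i ⊔ j ≡ i′ ⊔ j′
unorderedCode-injective {i = i} {j} {i′} {j′} i<d i′<d =
  pair-injective (≤-<-trans (m⊓n≤m i j) i<d) (≤-<-trans (m⊓n≤m i′ j′) i′<d)

m⊓n+m⊔n≡m+n : ∀ m n → m ⊓ n + (m ⊔ n) ≡ m + n
m⊓n+m⊔n≡m+n m n with ≤-total m n
... | inj₁ m≤n = cong₂ _+_ (m≤n⇒m⊓n≡m m≤n) (m≤n⇒m⊔n≡n m≤n)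
... | inj₂ n≤m = trans (cong₂ _+_ (m≥n⇒m⊓n≡n n≤m) (m≥n⇒m⊔n≡m n≤m)) (+-comm n m)

-- Knowing one entry, the code determines the other: i + j = min + max.
unorderedCode-cancelˡ : ∀ {d} .⦃ _ : NonZero d ⦄ {i j j′} → i < d →
                        unorderedCode d i j ≡ unorderedCode d i j′ → j ≡ j′
unorderedCode-cancelˡ {i = i} {j} {j′} i<d eq
  with min≡ , max≡ ← unorderedCode-injective i<d i<d eq =
  +-cancelˡ-≡ i j j′ (begin
    i + j                ≡⟨ ≡-sym (m⊓n+m⊔n≡m+n i j) ⟩
    i ⊓ j + (i ⊔ j)      ≡⟨ cong₂ _+_ min≡ max≡ ⟩
    i ⊓ j′ + (i ⊔ j′)    ≡⟨ m⊓n+m⊔n≡m+n i j′ ⟩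
    i + j′               ∎)
  where open ≡-Reasoning

unorderedCode-ordered : ∀ {d} .⦃ _ : NonZero d ⦄ {i j i′ j′} → i ≤ j → i′ ≤ j′ →
                        i < d → i′ < d →
                        unorderedCode d i j ≡ unorderedCode d i′ j′ → i ≡ i′ × j ≡ j′
unorderedCode-ordered i≤j i′≤j′ i<d i′<d eq
  with unorderedCode-injective i<d i′<d eq
... | min≡ , max≡
  rewrite m≤n⇒m⊓n≡m i≤j | m≤n⇒m⊔n≡n i≤j | m≤n⇒m⊓n≡m i′≤j′ | m≤n⇒m⊔n≡n i′≤j′ = min≡ , max≡

-- Vertex u lies in class ⌊u/3⌋, so class q is {3q, 3q+1, 3q+2}.
cls : ∀ {N} → Fin N → ℕ
cls u = toℕ u / 3

-- Classes of vertices of K_N are below N + 1, the base of the colour code.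
cls< : ∀ {N} (u : Fin N) → cls u < suc N
cls< u = ≤-<-trans (m/n≤m (toℕ u) 3) (m<n⇒m<1+n (Fin.toℕ<n u))

block : ℕ → List ℕ
block q = 0 + q * 3 ∷ 1 + q * 3 ∷ 2 + q * 3 ∷ []

∈-block : ∀ m → m ∈ block (m / 3)
∈-block m with m % 3 | m%n<n m 3 | m≡m%n+[m/n]*n m 3
... | 0 | _ | m≡ = here m≡
... | 1 | _ | m≡ = there (here m≡)
... | 2 | _ | m≡ = there (there (here m≡))
... | suc (suc (suc _)) | s≤s (s≤s (s≤s ())) | _

classColouring : (N : ℕ) → EdgeColoring N
classColouring N = record
  { col = λ u v → unorderedCode (suc N) (cls u) (cls v)
  ; sym = λ u v → unorderedCode-comm (suc N) (cls u) (cls v)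
  }

-- The edges of colour a at v all lead into one class, which has three vertices.
classColouring-local : ∀ N → LocallyBounded 3 (classColouring N)
classColouring-local N v a =
  filter-cluster-≤ P? toℕ Fin.toℕ-injective (λ x → block (cls x)) 3 (λ _ → ≤-refl)
    sameBlock (allFin N) (Unique.allFin⁺ N)
  where
  c = classColouring N
  P? = λ u → (col c v u ≟ a) ×-dec ¬? (u Fin.≟ v)
  sameBlock : ∀ x y → col c v x ≡ a × x ≢ v → col c v y ≡ a × y ≢ v → toℕ y ∈ block (cls x)
  sameBlock x y (x-col , _) (y-col , _) =
    subst (λ q → toℕ y ∈ block q)
      (unorderedCode-cancelˡ (cls< v) (trans y-col (≡-sym x-col)))
      (∈-block (toℕ y))

-- The edges u < v of colour a all join the same two classes, so the endpoint
-- pair ranges over 3 · 3 possibilities.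
classColouring-global : ∀ N → GloballyBounded 9 (classColouring N)
classColouring-global N a =
  filter-cluster-≤ P? toℕ² toℕ²-injective blocks 9 (λ _ → ≤-refl) sameBlocks
    (cartesianProduct (allFin N) (allFin N))
    (Unique.cartesianProduct⁺ (Unique.allFin⁺ N) (Unique.allFin⁺ N))
  where
  c = classColouring N
  P? = λ p → (proj₁ p Fin.<? proj₂ p) ×-dec (col c (proj₁ p) (proj₂ p) ≟ a)
  toℕ² : Fin N × Fin N → ℕ × ℕ
  toℕ² (x , y) = toℕ x , toℕ y
  toℕ²-injective : Injective _≡_ _≡_ toℕ²
  toℕ²-injective eq =
    cong₂ _,_ (Fin.toℕ-injective (cong proj₁ eq)) (Fin.toℕ-injective (cong proj₂ eq))
  blocks : Fin N × Fin N → List (ℕ × ℕ)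
  blocks (x , y) = cartesianProduct (block (cls x)) (block (cls y))
  cls-mono : ∀ {x y : Fin N} → x Fin.< y → cls x ≤ cls y
  cls-mono x<y = /-monoˡ-≤ 3 (<⇒≤ x<y)
  sameBlocks : ∀ p p′ → (proj₁ p Fin.< proj₂ p) × (col c (proj₁ p) (proj₂ p) ≡ a) →
               (proj₁ p′ Fin.< proj₂ p′) × (col c (proj₁ p′) (proj₂ p′) ≡ a) →
               toℕ² p′ ∈ blocks p
  sameBlocks (x , y) (x′ , y′) (x<y , xy-col) (x′<y′ , x′y′-col)
    with unorderedCode-ordered (cls-mono x<y) (cls-mono x′<y′) (cls< x) (cls< x′)
           (trans xy-col (≡-sym x′y′-col))
  ... | cls-x≡ , cls-y≡ rewrite cls-x≡ | cls-y≡ =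
    ∈-cartesianProduct⁺ (∈-block (toℕ x′)) (∈-block (toℕ y′))

Twins : ∀ {N} → EdgeColoring N → Fin N → Fin N → Set
Twins c x y = ∀ w → col c w x ≡ col c w y

TwoTwins : ∀ {N} → EdgeColoring N → Fin N → Set
TwoTwins c r = ∃[ y ] ∃[ z ] (y ≢ z × r ≢ y × r ≢ z × Twins c r y × Twins c r z)

-- If r reaches every vertex within two steps of a properly coloured H, then r
-- is adjacent to each of its twins x: a path r – w – x would give w two edges
-- of the same colour.
twin-adjacent : ∀ {N} {c : EdgeColoring N} {H : SpanningSubgraph N} {r x : Fin N} →
                ProperlyColored c H → (∀ v → WithinDist H 2 r v) →
                r ≢ x → Twins c r x → Adj H r x
twin-adjacent {H = H} {r} {x} proper reach r≢x twin with reach x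
... | inj₁ (inj₁ r≡x)                 = ⊥-elim (r≢x r≡x)
... | inj₁ (inj₂ (_ , r~x , refl))    = r~x
... | inj₂ (_ , r~x , inj₁ refl)      = r~x
... | inj₂ (w , r~w , inj₂ (_ , w~x , refl)) =
  ⊥-elim (proper w r x r≢x (adjSym H r~w) w~x (twin w))

no-proper-radius-two : ∀ {N} (c : EdgeColoring N) → (∀ r → TwoTwins c r) →
                       ¬ HasProperSpanningTreeRadiusTwo c
no-proper-radius-two c twins (H , _ , ((r , reach) , _) , proper)
  with y , z , y≢z , r≢y , r≢z , twin-y , twin-z ← twins r =
  proper r y z y≢z (twin-adjacent {c = c} {H} proper reach r≢y twin-y)
                   (twin-adjacent {c = c} {H} proper reach r≢z twin-z)
                   (trans (≡-sym (twin-y r)) (twin-z r))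

sameClass⇒twins : ∀ {N} (x y : Fin N) → cls x ≡ cls y → Twins (classColouring N) x y
sameClass⇒twins {N} _ _ cls≡ w = cong (unorderedCode (suc N) (cls w)) cls≡

injective-once : {A B : Set} {f : A → B} → Injective _≡_ _≡_ f →
                 ∀ {r i j} → r ≡ f i → i ≢ j → r ≢ f j
injective-once f-inj r≡fi i≢j r≡fj = i≢j (f-inj (trans (≡-sym r≡fi) r≡fj))

pattern 0F = Fin.zero
pattern 1F = Fin.suc 0F
pattern 2F = Fin.suc 1F

two-avoiding : {A : Set} → DecidableEquality A → (f : Fin 3 → A) → Injective _≡_ _≡_ f →
               (r : A) → ∃[ i ] ∃[ j ] (i ≢ j × r ≢ f i × r ≢ f j)
two-avoiding _≟_ f f-inj r with r ≟ f 0F | r ≟ f 1F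
... | yes r≡f0 | _        = 1F , 2F , (λ ()) , injective-once f-inj r≡f0 (λ ())
                                              , injective-once f-inj r≡f0 (λ ())
... | no r≢f0  | yes r≡f1 = 0F , 2F , (λ ()) , r≢f0 , injective-once f-inj r≡f1 (λ ())
... | no r≢f0  | no r≢f1  = 0F , 1F , (λ ()) , r≢f0 , r≢f1

module ClassOf (n : ℕ) (r : Fin (3 * n)) where

  cls-r<n : cls r < n
  cls-r<n = m<n*o⇒m/o<n (subst (toℕ r <_) (*-comm 3 n) (Fin.toℕ<n r))

  member-bound : (i : Fin 3) → toℕ i + cls r * 3 < 3 * n
  member-bound i = subst (toℕ i + cls r * 3 <_) (*-comm n 3)
    (≤-trans (+-monoˡ-< (cls r * 3) (Fin.toℕ<n i)) (*-monoˡ-≤ 3 cls-r<n))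

  member : Fin 3 → Fin (3 * n)
  member i = fromℕ< (member-bound i)

  toℕ-member : ∀ i → toℕ (member i) ≡ toℕ i + cls r * 3
  toℕ-member i = Fin.toℕ-fromℕ< (member-bound i)

  cls-member : ∀ i → cls (member i) ≡ cls r
  cls-member i = begin
    toℕ (member i) / 3         ≡⟨ cong (_/ 3) (toℕ-member i) ⟩
    (toℕ i + cls r * 3) / 3    ≡⟨ +-distrib-/-∣ʳ (toℕ i) (divides-refl (cls r)) ⟩
    toℕ i / 3 + cls r * 3 / 3  ≡⟨ cong₂ _+_ (m<n⇒m/n≡0 (Fin.toℕ<n i)) (m*n/n≡m (cls r) 3) ⟩
    cls r                      ∎
    where open ≡-Reasoning

  member-injective : Injective _≡_ _≡_ member
  member-injective {i} {j} eq = Fin.toℕ-injective (+-cancelʳ-≡ (cls r * 3) (toℕ i) (toℕ j)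
    (trans (≡-sym (toℕ-member i)) (trans (cong toℕ eq) (toℕ-member j))))

  classmates : TwoTwins (classColouring (3 * n)) r
  classmates with i , j , i≢j , r≢i , r≢j ← two-avoiding Fin._≟_ member member-injective r =
    member i , member j , i≢j ∘ member-injective , r≢i , r≢j ,
    sameClass⇒twins r (member i) (≡-sym (cls-member i)) ,
    sameClass⇒twins r (member j) (≡-sym (cls-member j))

lemma4p1 : ∀ (n : ℕ) → 1 ≤ n →
             Σ (EdgeColoring (3 * n)) (λ c →
               LocallyBounded 3 c × GloballyBounded 9 c × ¬ HasProperSpanningTreeRadiusTwo c)
lemma4p1 n _ =
  classColouring (3 * n) ,
  classColouring-local (3 * n) ,
  classColouring-global (3 * n) ,
  no-proper-radius-two (classColouring (3 * n)) (ClassOf.classmates n)
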